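{- Let $q$ be a power of $2$ with $q\equiv 1 \pmod 3$. In ${\rm AG}(2,q)$ the cubic curve with equation $X^2Y+XY^2+X^2+Y^2+XY=0$ has exactly $q-3$ points.
   Context: Points of the curve are the pairs $(x,y)\in{\mathbb F}_q^2$ satisfying the equation. -}

module Defs where

open import Level using (Level; _⊔_)
open import Algebra.Bundles using (CommutativeRing)
open import Data.Nat using (ℕ)
open import Data.Fin using (Fin)
open import Data.Product using (Σ; ∃; _×_)
open import Data.List using (List; length; filter; cartesianProduct)
open import Data.List using () renaming (allFin to allFinL)
open import Relation.Nullary using (¬_; Dec)
open import Relation.Binary using (Decidable)
open import Relation.Binary.PropositionalEquality using (_≡_)

record IsField {c ℓ} (R : CommutativeRing c ℓ) : Set (c ⊔ ℓ) where
  open CommutativeRing R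
  field
    1≉0     : ¬ (1# ≈ 0#)
    inverse : ∀ x → ¬ (x ≈ 0#) → ∃ λ y → (x * y) ≈ 1#

record FiniteField {c ℓ} (q : ℕ) : Set (Level.suc (c ⊔ ℓ)) where
  field
    cring    : CommutativeRing c ℓ
    isField  : IsField cring
  open CommutativeRing cring public hiding (ring)
  field
    enum      : Fin q → Carrier
    enum-inj  : ∀ i j → enum i ≈ enum j → i ≡ j
    enum-surj : ∀ x → ∃ λ i → enum i ≈ x
    _≟_       : Decidable _≈_

module _ {c ℓ} {q : ℕ} (F : FiniteField {c} {ℓ} q) where
  open FiniteField F

  numPoints : (Carrier → Carrier → Carrier) → ℕ
  numPoints f =
    length (filter (λ p → f (enum (Data.Product.proj₁ p)) (enum (Data.Product.proj₂ p)) ≟ 0#)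
                   (cartesianProduct (allFinL q) (allFinL q)))

  cubic : Carrier → Carrier → Carrier
  cubic x y = (x * x) * y + x * (y * y) + x * x + y * y + x * y

-- The origin is a double point of the cubic, so the curve is rational.  Writing a point off the
-- axis X = 0 as (x , t x), the equation becomes x² (x ℘(t) + ℘(t) + 1) = 0 with ℘(t) = t² + t
-- (characteristic 2), so the line of slope t ≠ 0 meets the curve again in exactly one affine point
-- unless t = 1 or ℘(t) = 1; the line of slope 0 meets it only at the origin, which is matched
-- with t = 0.  Points therefore correspond to slopes outside {1, ω, ω + 1}, where ℘(ω) = 1.  Such
-- an ω exists because t ↦ 1/(1 + t) permutes F ∖ {0, 1} with order 3 and its fixed points are
-- the roots of ℘(t) = 1: without one, 3 would divide q − 2, contradicting q ≡ 1 (mod 3).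
module Submission where

open import Defs
open import Data.Fin as Fin using (Fin)
open import Data.Fin.Properties using (any?)
open import Data.List using (List; []; _∷_; length; filter; map; allFin)
open import Data.List.Properties using (length-map; length-tabulate; map-∘; map-id-local)
open import Data.List.Membership.Propositional using (_∈_; _∉_)
open import Data.List.Membership.Propositional.Properties
  using (∈-filter⁺; ∈-filter⁻; ∈-map⁺; ∈-map⁻; ∈-allFin; ∈-cartesianProduct⁺)
open import Data.List.Membership.Propositional.Properties.WithK using (unique∧set⇒bag)
import Data.List.Membership.DecPropositional as DecMembership
open import Data.List.Relation.Binary.BagAndSetEquality using (_∼[_]_; set; ∼bag⇒↭)
open import Data.List.Relation.Binary.Permutation.Propositional.Properties using (↭-length)
import Data.List.Relation.Unary.All as All
open import Data.List.Relation.Unary.AllPairs as AllPairs using (AllPairs; []; _∷_)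
import Data.List.Relation.Unary.AllPairs.Properties as AllPairs
open import Data.List.Relation.Unary.Any as Any using (Any; here; there)
import Data.List.Relation.Unary.Any.Properties as Any
open import Data.List.Relation.Unary.Unique.Propositional using (Unique)
import Data.List.Relation.Unary.Unique.Propositional.Properties as Unique
import Data.Nat as Nat
open Nat using (ℕ; _^_; _%_; _∸_)
open import Data.Nat.Divisibility using (_∣_; divides; _∣0; ∣m∣n⇒∣m+n; ∣-refl)
open import Data.Nat.DivMod using ([m+kn]%n≡m%n)
open import Data.Nat.Induction using (<-wellFounded)
open import Data.Nat.Properties using (+-suc; m<n+m; m+n∸m≡n)
open import Data.Product using (∃; _×_; _,_; proj₁; proj₂)
open import Data.Sum using (_⊎_; inj₁; inj₂)
open import Function using (_∘_; id; _⇔_; mk⇔; Equivalence)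
open import Induction.WellFounded using (Acc; acc)
open import Level using (Level; _⊔_)
open import Relation.Binary using (DecidableEquality)
open import Relation.Binary.PropositionalEquality as ≡ using (_≡_; _≢_)
open import Relation.Nullary using (¬_; Dec; yes; no; ¬?; contradiction; _⊎-dec_)
open import Relation.Unary using (Pred; Decidable)
import Algebra.Solver.Ring.NaturalCoefficients.Default as NaturalSolver

module Counting where
  open ≡ using (refl; sym; trans; cong; subst; module ≡-Reasoning)
  open Nat using (suc; _+_; _<_; s≤s; z≤n)

  private
    variable
      a b p r : Level
      A B : Set a

  unique∧set⇒length-≡ : {xs ys : List A} → Unique xs → Unique ys → xs ∼[ set ] ys →
                        length xs ≡ length ys
  unique∧set⇒length-≡ xs! ys! xs∼ys = ↭-length (∼bag⇒↭ (unique∧set⇒bag xs! ys! xs∼ys))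

  length-filter-+-¬ : {P : Pred A p} (P? : Decidable P) (xs : List A) →
                      length (filter P? xs) + length (filter (¬? ∘ P?) xs) ≡ length xs
  length-filter-+-¬ P? []       = refl
  length-filter-+-¬ P? (x ∷ xs) with P? x
  ... | yes _ = cong suc (length-filter-+-¬ P? xs)
  ... | no  _ = trans (+-suc _ _) (cong suc (length-filter-+-¬ P? xs))

  record PredBijection {A : Set a} {B : Set b} (P : Pred A p) (Q : Pred B r) : Set (a ⊔ b ⊔ p ⊔ r) where
    field
      to      : A → B
      from    : B → A
      to-∈    : ∀ {x} → P x → Q (to x)
      from-∈  : ∀ {y} → Q y → P (from y)
      from∘to : ∀ {x} → P x → from (to x) ≡ x
      to∘from : ∀ {y} → Q y → to (from y) ≡ y

  module _ {P : Pred A p} {Q : Pred B r} (P? : Decidable P) (Q? : Decidable Q) where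

    length-filter-bijection : {xs : List A} {ys : List B} →
      Unique xs → Unique ys → (∀ x → x ∈ xs) → (∀ y → y ∈ ys) →
      PredBijection P Q → length (filter P? xs) ≡ length (filter Q? ys)
    length-filter-bijection {xs} {ys} xs! ys! x∈xs y∈ys P⇿Q = begin
      length (filter P? xs)          ≡⟨ unique∧set⇒length-≡ (Unique.filter⁺ P? xs!) image! same ⟩
      length (map from (filter Q? ys)) ≡⟨ length-map from (filter Q? ys) ⟩
      length (filter Q? ys)          ∎
      where
      open ≡-Reasoning
      open PredBijection P⇿Q
      Qys = filter Q? ys
      to∘from-on-Qys : map to (map from Qys) ≡ Qys
      to∘from-on-Qys = begin
        map to (map from Qys) ≡⟨ map-∘ Qys ⟨
        map (to ∘ from) Qys   ≡⟨ map-id-local (All.tabulate (to∘from ∘ proj₂ ∘ ∈-filter⁻ Q? {xs = ys})) ⟩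
        Qys                   ∎
      image! : Unique (map from Qys)
      image! = Unique.map⁻ {f = to} (subst Unique (sym to∘from-on-Qys) (Unique.filter⁺ Q? ys!))
      same : filter P? xs ∼[ set ] map from (filter Q? ys)
      same = mk⇔
        (λ z∈ → let Pz = proj₂ (∈-filter⁻ P? {xs = xs} z∈) in
          subst (_∈ map from Qys) (from∘to Pz) (∈-map⁺ from (∈-filter⁺ Q? (y∈ys _) (to-∈ Pz))))
        (λ z∈ → let (y , y∈ , z≡) = ∈-map⁻ from {xs = Qys} z∈ in
          subst (_∈ filter P? xs) (sym z≡) (∈-filter⁺ P? (x∈xs _) (from-∈ (proj₂ (∈-filter⁻ Q? {xs = ys} y∈)))))

  module _ (_≟_ : DecidableEquality A) (ρ : A → A) where
    open DecMembership _≟_ using (_∈?_)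

    fixedPointFree-order-3⇒3∣length : ∀ {ys} → Unique ys →
      (∀ {y} → y ∈ ys → ρ y ∈ ys) →
      (∀ {y} → y ∈ ys → ρ (ρ (ρ y)) ≡ y) →
      (∀ {y} → y ∈ ys → ρ y ≢ y) →
      3 ∣ length ys
    fixedPointFree-order-3⇒3∣length = go (<-wellFounded _)
      where
      go : ∀ {ys} → Acc _<_ (length ys) → Unique ys →
           (∀ {y} → y ∈ ys → ρ y ∈ ys) →
           (∀ {y} → y ∈ ys → ρ (ρ (ρ y)) ≡ y) →
           (∀ {y} → y ∈ ys → ρ y ≢ y) →
           3 ∣ length ys
      go {[]}     _        _   _      _     _   = 3 ∣0
      go {y ∷ ys} (acc rs) ys! closed ρ³≡id fixed-free =
        subst (3 ∣_) split (∣m∣n⇒∣m+n ∣-refl (go (rs shorter) rest! rest-closed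
          (ρ³≡id ∘ rest⊆) (fixed-free ∘ rest⊆)))
        where
        orbit = y ∷ ρ y ∷ ρ (ρ y) ∷ []
        rest = filter (¬? ∘ (_∈? orbit)) (y ∷ ys)

        rest⊆ : ∀ {z} → z ∈ rest → z ∈ y ∷ ys
        rest⊆ = proj₁ ∘ ∈-filter⁻ (¬? ∘ (_∈? orbit)) {xs = y ∷ ys}

        y∈ : y ∈ y ∷ ys
        y∈ = here refl

        orbit! : Unique orbit
        orbit! = (ρy≢y ∘ sym All.∷ ρρy≢y ∘ sym All.∷ All.[]) ∷ (ρρy≢ρy ∘ sym All.∷ All.[]) ∷ All.[] ∷ []
          where
          ρy≢y = fixed-free y∈
          ρρy≢ρy = fixed-free (closed y∈)
          ρρy≢y : ρ (ρ y) ≢ y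
          ρρy≢y e = ρy≢y (trans (sym (cong ρ e)) (ρ³≡id y∈))

        orbit⊆ : ∀ {z} → z ∈ orbit → z ∈ y ∷ ys
        orbit⊆ (here refl)                 = y∈
        orbit⊆ (there (here refl))         = closed y∈
        orbit⊆ (there (there (here refl))) = closed (closed y∈)

        ρρ-orbit : ∀ {z} → z ∈ orbit → ρ (ρ z) ∈ orbit
        ρρ-orbit (here refl)                 = there (there (here refl))
        ρρ-orbit (there (here refl))         = here (ρ³≡id y∈)
        ρρ-orbit (there (there (here refl))) = there (here (cong ρ (ρ³≡id y∈)))

        orbit-length : length (filter (_∈? orbit) (y ∷ ys)) ≡ 3
        orbit-length = unique∧set⇒length-≡ (Unique.filter⁺ (_∈? orbit) ys!) orbit!
          (mk⇔ (proj₂ ∘ ∈-filter⁻ (_∈? orbit) {xs = y ∷ ys})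
               (λ z∈ → ∈-filter⁺ (_∈? orbit) (orbit⊆ z∈) z∈))

        split : 3 + length rest ≡ length (y ∷ ys)
        split = trans (cong (_+ length rest) (sym orbit-length)) (length-filter-+-¬ (_∈? orbit) (y ∷ ys))

        shorter : length rest < length (y ∷ ys)
        shorter = subst (length rest <_) split (m<n+m (length rest) (s≤s z≤n))

        rest! : Unique rest
        rest! = Unique.filter⁺ (¬? ∘ (_∈? orbit)) ys!

        rest-closed : ∀ {z} → z ∈ rest → ρ z ∈ rest
        rest-closed {z} z∈ = ∈-filter⁺ (¬? ∘ (_∈? orbit)) (closed z∈ys) ρz∉orbit
          where
          z∈ys = rest⊆ z∈
          z∉orbit = proj₂ (∈-filter⁻ (¬? ∘ (_∈? orbit)) {xs = y ∷ ys} z∈)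
          ρz∉orbit : ρ z ∉ orbit
          ρz∉orbit ρz∈ = z∉orbit (subst (_∈ orbit) (ρ³≡id z∈ys) (ρρ-orbit ρz∈))

open Counting

3∣n⇒[2+n]%3≡2 : ∀ {n} → 3 ∣ n → (2 Nat.+ n) % 3 ≡ 2
3∣n⇒[2+n]%3≡2 (divides k ≡.refl) = [m+kn]%n≡m%n 2 k 3

module FiniteFieldProperties {c ℓ} {q : ℕ} (F : FiniteField {c} {ℓ} q) where
  open FiniteField F
  open IsField isField using (1≉0; inverse)
  open import Relation.Binary.Reasoning.Setoid setoid
  open NaturalSolver commutativeSemiring using (solve; _:=_; _:+_; _:*_; con)

  -- Junk value 0# ⁻¹ = 0#, which makes the parametrisation below total.
  infix 8 _⁻¹
  _⁻¹ : Carrier → Carrier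
  x ⁻¹ with x ≟ 0#
  ... | yes _   = 0#
  ... | no x≉0 = proj₁ (inverse x x≉0)

  x*x⁻¹≈1 : ∀ {x} → x ≉ 0# → x * x ⁻¹ ≈ 1#
  x*x⁻¹≈1 {x} x≉0 with x ≟ 0#
  ... | yes x≈0  = contradiction x≈0 x≉0
  ... | no  x≉0′ = proj₂ (inverse x x≉0′)

  x≈0⇒x⁻¹≈0 : ∀ {x} → x ≈ 0# → x ⁻¹ ≈ 0#
  x≈0⇒x⁻¹≈0 {x} x≈0 with x ≟ 0#
  ... | yes _   = refl
  ... | no x≉0 = contradiction x≈0 x≉0

  x*y≈1⇒y≈x⁻¹ : ∀ {x y} → x * y ≈ 1# → y ≈ x ⁻¹
  x*y≈1⇒y≈x⁻¹ {x} {y} xy≈1 = begin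
    y                 ≈⟨ *-identityʳ y ⟨
    y * 1#            ≈⟨ *-congˡ (x*x⁻¹≈1 x≉0) ⟨
    y * (x * x ⁻¹)    ≈⟨ reassociate x y (x ⁻¹) ⟩
    (x * y) * x ⁻¹    ≈⟨ *-congʳ xy≈1 ⟩
    1# * x ⁻¹         ≈⟨ *-identityˡ (x ⁻¹) ⟩
    x ⁻¹              ∎
    where
    x≉0 : x ≉ 0#
    x≉0 x≈0 = 1≉0 (trans (sym xy≈1) (trans (*-congʳ x≈0) (zeroˡ y)))
    reassociate : ∀ x y z → y * (x * z) ≈ (x * y) * z
    reassociate = solve 3 (λ x y z → y :* (x :* z) := (x :* y) :* z) refl

  ⁻¹-cong : ∀ {x y} → x ≈ y → x ⁻¹ ≈ y ⁻¹
  ⁻¹-cong {x} {y} x≈y = by-cases (x ≟ 0#)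
    where
    by-cases : Dec (x ≈ 0#) → x ⁻¹ ≈ y ⁻¹
    by-cases (yes x≈0) = trans (x≈0⇒x⁻¹≈0 x≈0) (sym (x≈0⇒x⁻¹≈0 (trans (sym x≈y) x≈0)))
    by-cases (no  x≉0) = x*y≈1⇒y≈x⁻¹ (trans (*-congʳ (sym x≈y)) (x*x⁻¹≈1 x≉0))

  infixl 7 _/_
  _/_ : Carrier → Carrier → Carrier
  x / y = x * y ⁻¹

  /-cong : ∀ {x x′ y y′} → x ≈ x′ → y ≈ y′ → x / y ≈ x′ / y′
  /-cong x≈x′ y≈y′ = *-cong x≈x′ (⁻¹-cong y≈y′)

  [x/y]*y≈x : ∀ x {y} → y ≉ 0# → (x / y) * y ≈ x
  [x/y]*y≈x x {y} y≉0 = begin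
    (x * y ⁻¹) * y  ≈⟨ *-assoc x (y ⁻¹) y ⟩
    x * (y ⁻¹ * y)  ≈⟨ *-congˡ (trans (*-comm (y ⁻¹) y) (x*x⁻¹≈1 y≉0)) ⟩
    x * 1#          ≈⟨ *-identityʳ x ⟩
    x               ∎

  [x*y]/y≈x : ∀ x {y} → y ≉ 0# → (x * y) / y ≈ x
  [x*y]/y≈x x {y} y≉0 = begin
    (x * y) * y ⁻¹  ≈⟨ *-assoc x y (y ⁻¹) ⟩
    x * (y * y ⁻¹)  ≈⟨ *-congˡ (x*x⁻¹≈1 y≉0) ⟩
    x * 1#          ≈⟨ *-identityʳ x ⟩
    x               ∎

  x≈0⇒x/y≈0 : ∀ {x} y → x ≈ 0# → x / y ≈ 0#
  x≈0⇒x/y≈0 y x≈0 = trans (*-congʳ x≈0) (zeroˡ (y ⁻¹))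

  y≈0⇒x/y≈0 : ∀ x {y} → y ≈ 0# → x / y ≈ 0#
  y≈0⇒x/y≈0 x y≈0 = trans (*-congˡ (x≈0⇒x⁻¹≈0 y≈0)) (zeroʳ x)

  x*y≈0⇒x≈0⊎y≈0 : ∀ {x y} → x * y ≈ 0# → x ≈ 0# ⊎ y ≈ 0#
  x*y≈0⇒x≈0⊎y≈0 {x} {y} xy≈0 with x ≟ 0#
  ... | yes x≈0 = inj₁ x≈0
  ... | no  x≉0 = inj₂ (begin
    y                 ≈⟨ *-identityˡ y ⟨
    1# * y            ≈⟨ *-congʳ (x*x⁻¹≈1 x≉0) ⟨
    (x * x ⁻¹) * y    ≈⟨ reassociate x (x ⁻¹) y ⟩
    x ⁻¹ * (x * y)    ≈⟨ *-congˡ xy≈0 ⟩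
    x ⁻¹ * 0#         ≈⟨ zeroʳ (x ⁻¹) ⟩
    0#                ∎)
    where
    reassociate : ∀ x y z → (x * y) * z ≈ y * (x * z)
    reassociate = solve 3 (λ x y z → (x :* y) :* z := y :* (x :* z)) refl

  x≉0∧y≉0⇒x*y≉0 : ∀ {x y} → x ≉ 0# → y ≉ 0# → x * y ≉ 0#
  x≉0∧y≉0⇒x*y≉0 x≉0 y≉0 xy≈0 with x*y≈0⇒x≈0⊎y≈0 xy≈0
  ... | inj₁ x≈0 = x≉0 x≈0
  ... | inj₂ y≈0 = y≉0 y≈0

  idx : Carrier → Fin q
  idx x = proj₁ (enum-surj x)

  enum-idx : ∀ x → enum (idx x) ≈ x
  enum-idx x = proj₂ (enum-surj x)

  enum≈⇒idx≡ : ∀ {i x} → enum i ≈ x → idx x ≡ i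
  enum≈⇒idx≡ {i} {x} eᵢ≈x = enum-inj (idx x) i (trans (enum-idx x) (sym eᵢ≈x))

  idx-injective : ∀ {x y} → idx x ≡ idx y → x ≈ y
  idx-injective {x} {y} idx≡ = trans (sym (enum-idx x)) (trans (reflexive (≡.cong enum idx≡)) (enum-idx y))

  count : ∀ {p} {P : Pred Carrier p} → Decidable P → ℕ
  count P? = length (filter (P? ∘ enum) (allFin q))

  count-+-count-¬ : ∀ {p} {P : Pred Carrier p} (P? : Decidable P) → count P? Nat.+ count (¬? ∘ P?) ≡ q
  count-+-count-¬ P? = ≡.trans (length-filter-+-¬ (P? ∘ enum) (allFin q)) (length-tabulate id)

  count-≡-length : ∀ {p} {P : Pred Carrier p} (P? : Decidable P) (es : List Carrier) →
    AllPairs _≉_ es → (∀ {x} → P x ⇔ Any (x ≈_) es) → count P? ≡ length es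
  count-≡-length P? es es-distinct P⇔∈es =
    ≡.trans (unique∧set⇒length-≡ (Unique.filter⁺ (P? ∘ enum) (Unique.allFin⁺ q)) idx-es! same)
            (length-map idx es)
    where
    idx-es! : Unique (map idx es)
    idx-es! = AllPairs.map⁺ (AllPairs.map (λ e≉e′ → e≉e′ ∘ idx-injective) es-distinct)
    same : filter (P? ∘ enum) (allFin q) ∼[ set ] map idx es
    same = mk⇔
      (λ k∈ → Any.map⁺ (Any.map (λ eₖ≈e → ≡.sym (enum≈⇒idx≡ eₖ≈e))
        (Equivalence.to P⇔∈es (proj₂ (∈-filter⁻ (P? ∘ enum) {xs = allFin q} k∈)))))
      (λ k∈ → ∈-filter⁺ (P? ∘ enum) (∈-allFin _) (Equivalence.from P⇔∈es
        (Any.map (λ k≡ → trans (reflexive (≡.cong enum k≡)) (enum-idx _)) (Any.map⁻ k∈))))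

  cubic-cong : ∀ {x x′ y y′} → x ≈ x′ → y ≈ y′ → cubic F x y ≈ cubic F x′ y′
  cubic-cong x≈x′ y≈y′ =
    +-cong (+-cong (+-cong (+-cong (*-cong (*-cong x≈x′ x≈x′) y≈y′) (*-cong x≈x′ (*-cong y≈y′ y≈y′)))
      (*-cong x≈x′ x≈x′)) (*-cong y≈y′ y≈y′)) (*-cong x≈x′ y≈y′)

  module CharacteristicTwo (1+1≈0 : 1# + 1# ≈ 0#) where

    x+x≈0 : ∀ x → x + x ≈ 0#
    x+x≈0 x = begin
      x + x          ≈⟨ solve 1 (λ x → x :+ x := x :* (con 1 :+ con 1)) refl x ⟩
      x * (1# + 1#)  ≈⟨ *-congˡ 1+1≈0 ⟩
      x * 0#         ≈⟨ zeroʳ x ⟩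
      0#             ∎

    x+y≈z⇒x≈z+y : ∀ {x y z} → x + y ≈ z → x ≈ z + y
    x+y≈z⇒x≈z+y {x} {y} {z} x+y≈z = begin
      x            ≈⟨ +-identityʳ x ⟨
      x + 0#       ≈⟨ +-congˡ (x+x≈0 y) ⟨
      x + (y + y)  ≈⟨ +-assoc x y y ⟨
      (x + y) + y  ≈⟨ +-congʳ x+y≈z ⟩
      z + y        ∎

    x+y≈x⇒y≈0 : ∀ {x y} → x + y ≈ x → y ≈ 0#
    x+y≈x⇒y≈0 {x} {y} x+y≈x = trans (x+y≈z⇒x≈z+y (trans (+-comm y x) x+y≈x)) (x+x≈0 x)

    -- The Artin–Schreier map; ℘ t ≈ 1# says that t is a primitive cube root of unity.
    ℘ : Carrier → Carrier
    ℘ t = t * t + t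

    ℘-cong : ∀ {s t} → s ≈ t → ℘ s ≈ ℘ t
    ℘-cong s≈t = +-cong (*-cong s≈t s≈t) s≈t

    ℘0≈0 : ℘ 0# ≈ 0#
    ℘0≈0 = solve 0 (con 0 :* con 0 :+ con 0 := con 0) refl

    ℘1≈0 : ℘ 1# ≈ 0#
    ℘1≈0 = trans (+-congʳ (*-identityˡ 1#)) 1+1≈0

    ℘-+ : ∀ s t → ℘ (s + t) ≈ ℘ s + ℘ t
    ℘-+ s t = begin
      ℘ (s + t)                        ≈⟨ expand s t ⟩
      ℘ s + ℘ t + (s * t + s * t)      ≈⟨ +-congˡ (x+x≈0 (s * t)) ⟩
      ℘ s + ℘ t + 0#                   ≈⟨ +-identityʳ _ ⟩
      ℘ s + ℘ t                        ∎
      where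
      expand : ∀ s t → ℘ (s + t) ≈ ℘ s + ℘ t + (s * t + s * t)
      expand = solve 2 (λ s t → (s :+ t) :* (s :+ t) :+ (s :+ t)
                              := (s :* s :+ s) :+ (t :* t :+ t) :+ (s :* t :+ s :* t)) refl

    ℘≈0⇒≈0⊎≈1 : ∀ {t} → ℘ t ≈ 0# → t ≈ 0# ⊎ t ≈ 1#
    ℘≈0⇒≈0⊎≈1 {t} ℘t≈0 with x*y≈0⇒x≈0⊎y≈0 (trans (factor t) ℘t≈0)
      where
      factor : ∀ t → t * (t + 1#) ≈ ℘ t
      factor = solve 1 (λ t → t :* (t :+ con 1) := t :* t :+ t) refl
    ... | inj₁ t≈0   = inj₁ t≈0
    ... | inj₂ t+1≈0 = inj₂ (trans (x+y≈z⇒x≈z+y t+1≈0) (+-identityˡ 1#))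

    ℘≈1⇒≈ω⊎≈ω+1 : ∀ {ω t} → ℘ ω ≈ 1# → ℘ t ≈ 1# → t ≈ ω ⊎ t ≈ ω + 1#
    ℘≈1⇒≈ω⊎≈ω+1 {ω} {t} ℘ω≈1 ℘t≈1 with ℘≈0⇒≈0⊎≈1 ℘[t+ω]≈0
      where
      ℘[t+ω]≈0 : ℘ (t + ω) ≈ 0#
      ℘[t+ω]≈0 = trans (℘-+ t ω) (trans (+-cong ℘t≈1 ℘ω≈1) 1+1≈0)
    ... | inj₁ t+ω≈0 = inj₁ (trans (x+y≈z⇒x≈z+y t+ω≈0) (+-identityˡ ω))
    ... | inj₂ t+ω≈1 = inj₂ (trans (x+y≈z⇒x≈z+y t+ω≈1) (+-comm 1# ω))

    -- The line Y = t X through the double point (0 , 0) meets the curve again at X = abscissa t.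
    abscissa : Carrier → Carrier
    abscissa t = (℘ t + 1#) / ℘ t

    abscissa-cong : ∀ {s t} → s ≈ t → abscissa s ≈ abscissa t
    abscissa-cong s≈t = /-cong (+-congʳ (℘-cong s≈t)) (℘-cong s≈t)

    Exceptional : Carrier → Set ℓ
    Exceptional t = t ≈ 1# ⊎ ℘ t ≈ 1#

    exceptional-resp : ∀ {s t} → s ≈ t → Exceptional s → Exceptional t
    exceptional-resp s≈t (inj₁ s≈1)  = inj₁ (trans (sym s≈t) s≈1)
    exceptional-resp s≈t (inj₂ ℘s≈1) = inj₂ (trans (℘-cong (sym s≈t)) ℘s≈1)

    cubic-on-line : ∀ x t → cubic F x (t * x) ≈ (x * x) * (x * ℘ t + (℘ t + 1#))
    cubic-on-line = solve 2 (λ x t →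
        (x :* x) :* (t :* x) :+ x :* ((t :* x) :* (t :* x)) :+ x :* x :+ (t :* x) :* (t :* x) :+ x :* (t :* x)
      := (x :* x) :* (x :* (t :* t :+ t) :+ ((t :* t :+ t) :+ con 1))) refl

    cubic-on-axis : ∀ y → cubic F 0# y ≈ y * y
    cubic-on-axis = solve 1 (λ y →
      (con 0 :* con 0) :* y :+ con 0 :* (y :* y) :+ con 0 :* con 0 :+ y :* y :+ con 0 :* y := y :* y) refl

    on-curve-off-axis : ∀ {x y} → x ≉ 0# → cubic F x y ≈ 0# → x * ℘ (y / x) ≈ ℘ (y / x) + 1#
    on-curve-off-axis {x} {y} x≉0 on-curve with x*y≈0⇒x≈0⊎y≈0 factorised≈0
      where
      factorised≈0 : (x * x) * (x * ℘ (y / x) + (℘ (y / x) + 1#)) ≈ 0#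
      factorised≈0 = trans (sym (cubic-on-line x (y / x))) (trans (cubic-cong refl ([x/y]*y≈x y x≉0)) on-curve)
    ... | inj₁ x*x≈0 = contradiction x*x≈0 (x≉0∧y≉0⇒x*y≉0 x≉0 x≉0)
    ... | inj₂ sum≈0 = trans (x+y≈z⇒x≈z+y sum≈0) (+-identityˡ _)

    on-curve-on-axis : ∀ {x y} → x ≈ 0# → cubic F x y ≈ 0# → y ≈ 0#
    on-curve-on-axis {x} {y} x≈0 on-curve with x*y≈0⇒x≈0⊎y≈0 y*y≈0
      where
      y*y≈0 : y * y ≈ 0#
      y*y≈0 = trans (sym (cubic-on-axis y)) (trans (cubic-cong (sym x≈0) refl) on-curve)
    ... | inj₁ y≈0 = y≈0
    ... | inj₂ y≈0 = y≈0

    x*u≈u+1⇒u≉0 : ∀ {x u} → x * u ≈ u + 1# → u ≉ 0#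
    x*u≈u+1⇒u≉0 {x} {u} rel u≈0 = 1≉0 (begin
      1#       ≈⟨ +-identityˡ 1# ⟨
      0# + 1#  ≈⟨ +-congʳ u≈0 ⟨
      u + 1#   ≈⟨ rel ⟨
      x * u    ≈⟨ *-congˡ u≈0 ⟩
      x * 0#   ≈⟨ zeroʳ x ⟩
      0#       ∎)

    x*u≈u+1⇒u≉1 : ∀ {x u} → x ≉ 0# → x * u ≈ u + 1# → u ≉ 1#
    x*u≈u+1⇒u≉1 {x} {u} x≉0 rel u≈1 = x≉0 (begin
      x        ≈⟨ *-identityʳ x ⟨
      x * 1#   ≈⟨ *-congˡ u≈1 ⟨
      x * u    ≈⟨ rel ⟩
      u + 1#   ≈⟨ +-congʳ u≈1 ⟩
      1# + 1#  ≈⟨ 1+1≈0 ⟩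
      0#       ∎)

    x*℘t≈℘t+1⇒abscissa≈x : ∀ {x t} → x * ℘ t ≈ ℘ t + 1# → abscissa t ≈ x
    x*℘t≈℘t+1⇒abscissa≈x {x} rel = trans (/-cong (sym rel) refl) ([x*y]/y≈x x (x*u≈u+1⇒u≉0 rel))

    ¬exceptional-0 : ¬ Exceptional 0#
    ¬exceptional-0 (inj₁ 0≈1)  = 1≉0 (sym 0≈1)
    ¬exceptional-0 (inj₂ ℘0≈1) = 1≉0 (trans (sym ℘0≈1) ℘0≈0)

    nonexceptional⇒℘≉0 : ∀ {t} → t ≉ 0# → ¬ Exceptional t → ℘ t ≉ 0#
    nonexceptional⇒℘≉0 t≉0 ¬exc ℘t≈0 with ℘≈0⇒≈0⊎≈1 ℘t≈0
    ... | inj₁ t≈0 = t≉0 t≈0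
    ... | inj₂ t≈1 = ¬exc (inj₁ t≈1)

    on-curve⇒nonexceptional : ∀ {x y} → cubic F x y ≈ 0# → ¬ Exceptional (y / x)
    on-curve⇒nonexceptional {x} {y} on-curve = by-cases (x ≟ 0#)
      where
      by-cases : Dec (x ≈ 0#) → ¬ Exceptional (y / x)
      by-cases (yes x≈0) = ¬exceptional-0 ∘ exceptional-resp (x≈0⇒x/y≈0 x (on-curve-on-axis x≈0 on-curve))
      by-cases (no  x≉0) = λ
        { (inj₁ t≈1)  → x*u≈u+1⇒u≉0 rel (trans (℘-cong t≈1) ℘1≈0)
        ; (inj₂ ℘t≈1) → x*u≈u+1⇒u≉1 x≉0 rel ℘t≈1 }
        where
        rel = on-curve-off-axis x≉0 on-curve

    on-curve⇒parametrised : ∀ {x y} → cubic F x y ≈ 0# →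
      abscissa (y / x) ≈ x × (y / x) * abscissa (y / x) ≈ y
    on-curve⇒parametrised {x} {y} on-curve = by-cases (x ≟ 0#)
      where
      t = y / x
      by-cases : Dec (x ≈ 0#) → abscissa t ≈ x × t * abscissa t ≈ y
      by-cases (yes x≈0) = trans X≈0 (sym x≈0) , trans (*-congˡ X≈0) (trans (zeroʳ t) (sym y≈0))
        where
        y≈0 = on-curve-on-axis x≈0 on-curve
        X≈0 = y≈0⇒x/y≈0 (℘ t + 1#) (trans (℘-cong (x≈0⇒x/y≈0 x y≈0)) ℘0≈0)
      by-cases (no  x≉0) = X≈x , trans (*-congˡ X≈x) ([x/y]*y≈x y x≉0)
        where
        X≈x = x*℘t≈℘t+1⇒abscissa≈x (on-curve-off-axis x≉0 on-curve)

    nonexceptional⇒on-curve : ∀ {t} → ¬ Exceptional t → cubic F (abscissa t) (t * abscissa t) ≈ 0#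
    nonexceptional⇒on-curve {t} ¬exc = by-cases (t ≟ 0#)
      where
      X = abscissa t
      by-cases : Dec (t ≈ 0#) → cubic F X (t * X) ≈ 0#
      by-cases (yes t≈0) = begin
        cubic F X (t * X)  ≈⟨ cubic-cong X≈0 (trans (*-congʳ t≈0) (zeroˡ X)) ⟩
        cubic F 0# 0#      ≈⟨ cubic-on-axis 0# ⟩
        0# * 0#            ≈⟨ zeroˡ 0# ⟩
        0#                 ∎
        where
        X≈0 = y≈0⇒x/y≈0 (℘ t + 1#) (trans (℘-cong t≈0) ℘0≈0)
      by-cases (no  t≉0) = begin
        cubic F X (t * X)                      ≈⟨ cubic-on-line X t ⟩
        (X * X) * (X * ℘ t + (℘ t + 1#))       ≈⟨ *-congˡ (+-congʳ ([x/y]*y≈x (℘ t + 1#) (nonexceptional⇒℘≉0 t≉0 ¬exc))) ⟩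
        (X * X) * ((℘ t + 1#) + (℘ t + 1#))    ≈⟨ *-congˡ (x+x≈0 (℘ t + 1#)) ⟩
        (X * X) * 0#                           ≈⟨ zeroʳ (X * X) ⟩
        0#                                     ∎

    nonexceptional⇒[t*abscissa]/abscissa≈t : ∀ {t} → ¬ Exceptional t → (t * abscissa t) / abscissa t ≈ t
    nonexceptional⇒[t*abscissa]/abscissa≈t {t} ¬exc = by-cases (t ≟ 0#)
      where
      X = abscissa t
      by-cases : Dec (t ≈ 0#) → (t * X) / X ≈ t
      by-cases (yes t≈0) = trans (x≈0⇒x/y≈0 X (trans (*-congʳ t≈0) (zeroˡ X))) (sym t≈0)
      by-cases (no  t≉0) = [x*y]/y≈x t X≉0
        where
        X≉0 : X ≉ 0#
        X≉0 X≈0 = ¬exc (inj₂ (trans (x+y≈z⇒x≈z+y ℘t+1≈0) (+-identityˡ 1#)))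
          where
          ℘t+1≈0 : ℘ t + 1# ≈ 0#
          ℘t+1≈0 = trans (sym ([x/y]*y≈x (℘ t + 1#) (nonexceptional⇒℘≉0 t≉0 ¬exc)))
                         (trans (*-congʳ X≈0) (zeroˡ (℘ t)))

    σ : Carrier → Carrier
    σ t = (1# + t) ⁻¹

    σ-cong : ∀ {s t} → s ≈ t → σ s ≈ σ t
    σ-cong = ⁻¹-cong ∘ +-congˡ

    [1+t]*σt≈1 : ∀ {t} → t ≉ 1# → (1# + t) * σ t ≈ 1#
    [1+t]*σt≈1 {t} t≉1 = x*x⁻¹≈1 (λ 1+t≈0 → t≉1 (sym (trans (x+y≈z⇒x≈z+y 1+t≈0) (+-identityˡ t))))

    σ≉0 : ∀ {t} → t ≉ 1# → σ t ≉ 0#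
    σ≉0 {t} t≉1 σt≈0 = 1≉0 (trans (sym ([1+t]*σt≈1 t≉1)) (trans (*-congˡ σt≈0) (zeroʳ (1# + t))))

    σ≉1 : ∀ {t} → t ≉ 0# → t ≉ 1# → σ t ≉ 1#
    σ≉1 {t} t≉0 t≉1 σt≈1 = t≉0 (x+y≈x⇒y≈0 (begin
      1# + t           ≈⟨ *-identityʳ (1# + t) ⟨
      (1# + t) * 1#    ≈⟨ *-congˡ σt≈1 ⟨
      (1# + t) * σ t   ≈⟨ [1+t]*σt≈1 t≉1 ⟩
      1#               ∎))

    σ³≈id : ∀ {t} → t ≉ 0# → t ≉ 1# → σ (σ (σ t)) ≈ t
    σ³≈id {t} t≉0 t≉1 = sym (x*y≈1⇒y≈x⁻¹ [1+s₂]*t≈1)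
      where
      s₁ = σ t
      s₂ = σ s₁
      [1+s₁]*[1+t]≈t : (1# + s₁) * (1# + t) ≈ t
      [1+s₁]*[1+t]≈t = begin
        (1# + s₁) * (1# + t)        ≈⟨ solve 2 (λ s t → (con 1 :+ s) :* (con 1 :+ t) := (con 1 :+ t) :* s :+ con 1 :+ t) refl s₁ t ⟩
        (1# + t) * s₁ + 1# + t      ≈⟨ +-congʳ (+-congʳ ([1+t]*σt≈1 t≉1)) ⟩
        1# + 1# + t                 ≈⟨ +-congʳ 1+1≈0 ⟩
        0# + t                      ≈⟨ +-identityˡ t ⟩
        t                           ∎
      s₂*t≈1+t : s₂ * t ≈ 1# + t
      s₂*t≈1+t = begin
        s₂ * t                        ≈⟨ *-congˡ [1+s₁]*[1+t]≈t ⟨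
        s₂ * ((1# + s₁) * (1# + t))   ≈⟨ solve 3 (λ a b c → a :* (b :* c) := (b :* a) :* c) refl s₂ (1# + s₁) (1# + t) ⟩
        ((1# + s₁) * s₂) * (1# + t)   ≈⟨ *-congʳ ([1+t]*σt≈1 (σ≉1 t≉0 t≉1)) ⟩
        1# * (1# + t)                 ≈⟨ *-identityˡ (1# + t) ⟩
        1# + t                        ∎
      [1+s₂]*t≈1 : (1# + s₂) * t ≈ 1#
      [1+s₂]*t≈1 = begin
        (1# + s₂) * t    ≈⟨ solve 2 (λ s t → (con 1 :+ s) :* t := s :* t :+ t) refl s₂ t ⟩
        s₂ * t + t       ≈⟨ +-congʳ s₂*t≈1+t ⟩
        1# + t + t       ≈⟨ +-assoc 1# t t ⟩
        1# + (t + t)     ≈⟨ +-congˡ (x+x≈0 t) ⟩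
        1# + 0#          ≈⟨ +-identityʳ 1# ⟩
        1#               ∎

    σ-fixed⇒℘≈1 : ∀ {t} → t ≉ 1# → σ t ≈ t → ℘ t ≈ 1#
    σ-fixed⇒℘≈1 {t} t≉1 σt≈t = begin
      ℘ t             ≈⟨ solve 1 (λ t → t :* t :+ t := (con 1 :+ t) :* t) refl t ⟩
      (1# + t) * t    ≈⟨ *-congˡ σt≈t ⟨
      (1# + t) * σ t  ≈⟨ [1+t]*σt≈1 t≉1 ⟩
      1#              ∎

    exceptional? : Decidable Exceptional
    exceptional? t = t ≟ 1# ⊎-dec ℘ t ≟ 1#

    count-exceptional : ∀ {ω} → ℘ ω ≈ 1# → count exceptional? ≡ 3
    count-exceptional {ω} ℘ω≈1 = count-≡-length exceptional? (1# ∷ ω ∷ ω + 1# ∷ []) distinct (mk⇔ to from)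
      where
      ℘[ω+1]≈1 : ℘ (ω + 1#) ≈ 1#
      ℘[ω+1]≈1 = trans (℘-+ ω 1#) (trans (+-cong ℘ω≈1 ℘1≈0) (+-identityʳ 1#))
      ω≉1 : ω ≉ 1#
      ω≉1 ω≈1 = 1≉0 (trans (sym ℘ω≈1) (trans (℘-cong ω≈1) ℘1≈0))
      ω+1≉1 : ω + 1# ≉ 1#
      ω+1≉1 ω+1≈1 = 1≉0 (trans (sym ℘ω≈1) (trans (℘-cong (x+y≈x⇒y≈0 (trans (+-comm 1# ω) ω+1≈1))) ℘0≈0))
      ω+1≉ω : ω + 1# ≉ ω
      ω+1≉ω = 1≉0 ∘ x+y≈x⇒y≈0
      distinct : AllPairs _≉_ (1# ∷ ω ∷ ω + 1# ∷ [])
      distinct = (ω≉1 ∘ sym All.∷ ω+1≉1 ∘ sym All.∷ All.[]) ∷ (ω+1≉ω ∘ sym All.∷ All.[]) ∷ All.[] ∷ []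
      to : ∀ {t} → Exceptional t → Any (t ≈_) (1# ∷ ω ∷ ω + 1# ∷ [])
      to (inj₁ t≈1) = here t≈1
      to (inj₂ ℘t≈1) with ℘≈1⇒≈ω⊎≈ω+1 ℘ω≈1 ℘t≈1
      ... | inj₁ t≈ω   = there (here t≈ω)
      ... | inj₂ t≈ω+1 = there (there (here t≈ω+1))
      from : ∀ {t} → Any (t ≈_) (1# ∷ ω ∷ ω + 1# ∷ []) → Exceptional t
      from (here t≈1)                   = inj₁ t≈1
      from (there (here t≈ω))           = inj₂ (trans (℘-cong t≈ω) ℘ω≈1)
      from (there (there (here t≈ω+1))) = inj₂ (trans (℘-cong t≈ω+1) ℘[ω+1]≈1)

    numPoints≡count-nonexceptional : numPoints F (cubic F) ≡ count (¬? ∘ exceptional?)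
    numPoints≡count-nonexceptional = length-filter-bijection
      (λ p → cubic F (enum (proj₁ p)) (enum (proj₂ p)) ≟ 0#) ((¬? ∘ exceptional?) ∘ enum)
      (Unique.cartesianProduct⁺ (Unique.allFin⁺ q) (Unique.allFin⁺ q)) (Unique.allFin⁺ q)
      (λ (i , j) → ∈-cartesianProduct⁺ (∈-allFin i) (∈-allFin j)) ∈-allFin
      (record
        { to      = λ (i , j) → idx (enum j / enum i)
        ; from    = λ k → idx (abscissa (enum k)) , idx (enum k * abscissa (enum k))
        ; to-∈    = λ on-curve → on-curve⇒nonexceptional on-curve ∘ exceptional-resp (enum-idx _)
        ; from-∈  = λ ¬exc → trans (cubic-cong (enum-idx _) (enum-idx _)) (nonexceptional⇒on-curve ¬exc)
        ; from∘to = λ on-curve → let (X≈x , tX≈y) = on-curve⇒parametrised on-curve in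
            ≡.cong₂ _,_
              (enum≈⇒idx≡ (sym (trans (abscissa-cong (enum-idx _)) X≈x)))
              (enum≈⇒idx≡ (sym (trans (*-cong (enum-idx _) (abscissa-cong (enum-idx _))) tX≈y)))
        ; to∘from = λ ¬exc → enum≈⇒idx≡
            (sym (trans (/-cong (enum-idx _) (enum-idx _)) (nonexceptional⇒[t*abscissa]/abscissa≈t ¬exc)))
        })

    ZeroOrOne : Carrier → Set ℓ
    ZeroOrOne t = t ≈ 0# ⊎ t ≈ 1#

    zero-or-one? : Decidable ZeroOrOne
    zero-or-one? t = t ≟ 0# ⊎-dec t ≟ 1#

    count-zero-or-one : count zero-or-one? ≡ 2
    count-zero-or-one = count-≡-length zero-or-one? (0# ∷ 1# ∷ [])
      ((1≉0 ∘ sym All.∷ All.[]) ∷ All.[] ∷ []) (mk⇔ to from)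
      where
      to : ∀ {t} → ZeroOrOne t → Any (t ≈_) (0# ∷ 1# ∷ [])
      to (inj₁ t≈0) = here t≈0
      to (inj₂ t≈1) = there (here t≈1)
      from : ∀ {t} → Any (t ≈_) (0# ∷ 1# ∷ []) → ZeroOrOne t
      from (here t≈0)         = inj₁ t≈0
      from (there (here t≈1)) = inj₂ t≈1

    no-root⇒3∣count-¬zero-or-one : (∀ t → ℘ t ≉ 1#) → 3 ∣ count (¬? ∘ zero-or-one?)
    no-root⇒3∣count-¬zero-or-one no-root =
      fixedPointFree-order-3⇒3∣length Fin._≟_ ρ (Unique.filter⁺ _ (Unique.allFin⁺ q)) closed ρ³≡id fixed-free
      where
      ρ : Fin q → Fin q
      ρ k = idx (σ (enum k))
      U = filter ((¬? ∘ zero-or-one?) ∘ enum) (allFin q)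
      avoids-0-1 : ∀ {k} → k ∈ U → enum k ≉ 0# × enum k ≉ 1#
      avoids-0-1 k∈ = let (_ , ¬0∨1) = ∈-filter⁻ ((¬? ∘ zero-or-one?) ∘ enum) {xs = allFin q} k∈
                   in ¬0∨1 ∘ inj₁ , ¬0∨1 ∘ inj₂
      closed : ∀ {k} → k ∈ U → ρ k ∈ U
      closed k∈ = let (≉0 , ≉1) = avoids-0-1 k∈ in ∈-filter⁺ ((¬? ∘ zero-or-one?) ∘ enum) (∈-allFin _) λ
        { (inj₁ ≈0) → σ≉0 ≉1 (trans (sym (enum-idx _)) ≈0)
        ; (inj₂ ≈1) → σ≉1 ≉0 ≉1 (trans (sym (enum-idx _)) ≈1) }
      ρ³≡id : ∀ {k} → k ∈ U → ρ (ρ (ρ k)) ≡ k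
      ρ³≡id k∈ = let (≉0 , ≉1) = avoids-0-1 k∈ in enum-inj _ _
        (trans (enum-idx _) (trans (σ-cong (trans (enum-idx _) (σ-cong (enum-idx _)))) (σ³≈id ≉0 ≉1)))
      fixed-free : ∀ {k} → k ∈ U → ρ k ≢ k
      fixed-free {k} k∈ ρk≡k = no-root (enum k)
        (σ-fixed⇒℘≈1 (proj₂ (avoids-0-1 k∈)) (trans (sym (enum-idx _)) (reflexive (≡.cong enum ρk≡k))))

    ∃℘≈1 : q % 3 ≡ 1 → ∃ λ ω → ℘ ω ≈ 1#
    ∃℘≈1 q%3≡1 with any? (λ k → ℘ (enum k) ≟ 1#)
    ... | yes (k , ℘≈1) = enum k , ℘≈1
    ... | no  ∄k        = contradiction (≡.trans (≡.sym q%3≡1) q%3≡2) λ ()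
      where
      no-root : ∀ t → ℘ t ≉ 1#
      no-root t ℘t≈1 = ∄k (idx t , trans (℘-cong (enum-idx t)) ℘t≈1)
      q≡2+n : q ≡ 2 Nat.+ count (¬? ∘ zero-or-one?)
      q≡2+n = ≡.trans (≡.sym (count-+-count-¬ zero-or-one?))
                      (≡.cong (Nat._+ count (¬? ∘ zero-or-one?)) count-zero-or-one)
      q%3≡2 : q % 3 ≡ 2
      q%3≡2 = ≡.subst (λ n → n % 3 ≡ 2) (≡.sym q≡2+n) (3∣n⇒[2+n]%3≡2 (no-root⇒3∣count-¬zero-or-one no-root))

lemma2p2 : ∀ {c ℓ} (q : ℕ) (F : FiniteField {c} {ℓ} q)
           → (∃ λ n → q ≡ 2 ^ n)
           → FiniteField._≈_ F (FiniteField._+_ F (FiniteField.1# F) (FiniteField.1# F)) (FiniteField.0# F)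
           → q % 3 ≡ 1
           → numPoints F (cubic F) ≡ q ∸ 3
lemma2p2 q F _ 1+1≈0 q%3≡1 = begin
  numPoints F (cubic F)   ≡⟨ numPoints≡count-nonexceptional ⟩
  n                       ≡⟨ m+n∸m≡n 3 n ⟨
  3 Nat.+ n ∸ 3           ≡⟨ ≡.cong (λ m → m Nat.+ n ∸ 3) (count-exceptional ℘ω≈1) ⟨
  count exceptional? Nat.+ n ∸ 3 ≡⟨ ≡.cong (_∸ 3) (count-+-count-¬ exceptional?) ⟩
  q ∸ 3                   ∎
  where
  open ≡.≡-Reasoning
  open FiniteFieldProperties F using (count; count-+-count-¬)
  open FiniteFieldProperties.CharacteristicTwo F 1+1≈0
  n = count (¬? ∘ exceptional?)
  ℘ω≈1 = proj₂ (∃℘≈1 q%3≡1)
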